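{- For every integer $n\ge 6$, $$\beta_b(C(n;1,3))=\alpha(C(n;1,3))=\begin{cases}\dfrac{n}{2}, & \text{if } n \text{ is even},\\ \dfrac{n-3}{2}, & \text{otherwise.}\end{cases}$$
   Context: For integers $n\ge 3$ and $1\le a\le\lfloor n/2\rfloor$, the circulant graph $C(n;1,a)$ has vertex set $\{v_0,\dots,v_{n-1}\}$ and edges $v_iv_{i+1}$ and $v_iv_{i+a}$, subscripts modulo $n$. For a connected graph $G$, a broadcast is a function $f:V(G)\to\{0,\dots,\mathrm{diam}(G)\}$ with $f(v)\le e(v)$ (eccentricity) for all $v$; $V_f^+=\{v:f(v)>0\}$. $f$ is independent if $d(u,v)>\max\{f(u),f(v)\}$ for all distinct $u,v\in V_f^+$. The cost is $\sigma(f)=\sum_v f(v)$, and $\beta_b(G)$ is the maximum cost of an independent broadcast on $G$. $\alpha(G)$ denotes the independence number. -}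

module Defs where

open import Data.Nat using (ℕ; zero; suc; _+_; _≤_; _<_)
open import Data.Nat.DivMod using (_%_)
open import Data.Fin using (Fin; toℕ)
open import Data.Fin.Subset using (Subset; _∈_; ∣_∣)
open import Data.List using (map; allFin)
open import Data.Nat.ListAction using (sum)
open import Data.Product using (_×_; ∃; ∃-syntax)
open import Data.Sum using (_⊎_)
open import Relation.Nullary using (¬_)
open import Relation.Binary.PropositionalEquality using (_≡_)

Graph : ℕ → Set₁
Graph n = Fin n → Fin n → Set

-- (i + k) mod n on naturals (n = 0 never occurs for our graphs).
addMod : ℕ → ℕ → ℕ → ℕ
addMod zero    i k = 0
addMod (suc n) i k = (i + k) % suc n

Circulant : (n a : ℕ) → Graph n
Circulant n a i j =
  (toℕ j ≡ addMod n (toℕ i) 1) ⊎ (toℕ i ≡ addMod n (toℕ j) 1) ⊎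
  (toℕ j ≡ addMod n (toℕ i) a) ⊎ (toℕ i ≡ addMod n (toℕ j) a)

module _ {n : ℕ} (G : Graph n) where

  data Walk : ℕ → Fin n → Fin n → Set where
    nil  : ∀ {u} → Walk 0 u u
    cons : ∀ {k u w v} → G u w → Walk k w v → Walk (suc k) u v

  Dist : Fin n → Fin n → ℕ → Set
  Dist u v d = Walk d u v × (∀ k → Walk k u v → d ≤ k)

  IsEcc : Fin n → ℕ → Set
  IsEcc v e = (∃[ u ] Dist v u e) × (∀ u d → Dist v u d → d ≤ e)

  -- Broadcast: f(v) ≤ e(v) for every vertex (hence also f(v) ≤ diam G).
  IsBroadcast : (Fin n → ℕ) → Set
  IsBroadcast f = ∀ v → ∃[ e ] (IsEcc v e × f v ≤ e)

  IsIndependent : (Fin n → ℕ) → Set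
  IsIndependent f = ∀ u v → ¬ (u ≡ v) → 0 < f u → 0 < f v →
                    ∀ d → Dist u v d → (f u < d × f v < d)

  cost : (Fin n → ℕ) → ℕ
  cost f = sum (map f (allFin n))

  IsBroadcastIndependenceNumber : ℕ → Set
  IsBroadcastIndependenceNumber b =
    (∃[ f ] (IsBroadcast f × IsIndependent f × cost f ≡ b)) ×
    (∀ f → IsBroadcast f → IsIndependent f → cost f ≤ b)

  IsIndependentSet : Subset n → Set
  IsIndependentSet S = ∀ u v → u ∈ S → v ∈ S → ¬ G u v

  IsIndependenceNumber : ℕ → Set
  IsIndependenceNumber a =
    (∃[ S ] (IsIndependentSet S × ∣ S ∣ ≡ a)) ×
    (∀ S → IsIndependentSet S → ∣ S ∣ ≤ a)

-- Place the vertices on the n-cycle and let each broadcasting vertex v cover the arc of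
-- the 2 f(v) vertices v, v+1, ..., v+2f(v)-1. Walking with ⌊g/3⌋ steps of length 3 and
-- g mod 3 steps of length 1 reaches v+g, so independence forces the clockwise offset from
-- one broadcasting vertex to another to be at least twice the value of each; hence the arcs
-- are pairwise disjoint. They fit on the cycle since f(v) ≤ e(v) ≤ (n-2)/2, so 2σ(f) ≤ n.
-- For odd n some vertex w is uncovered. If both neighbours of w are covered, the arc ending
-- at w-1 must belong to a vertex v with f(v) = 2 whose arc is followed by a vertex
-- broadcasting from w+1, and then v-1 is uncovered; either way there are two uncovered
-- vertices and parity gives 2σ(f) ≤ n-3. The even vertices (below n-3 for odd n) form an
-- independent set attaining the bound, and an independent set is an independent broadcast
-- of value 1 on each of its vertices, so the same bound and witness give α.

{-# OPTIONS --safe #-}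
module Submission where

open import Defs
open import Data.Nat using (ℕ; zero; suc; _+_; _*_; _∸_; _/_; _%_; _≤_; _<_; _≰_; _≮_; _<?_; z≤n; s≤s; z<s)
open import Data.Nat.Properties
open import Data.Nat.DivMod
open import Data.Nat.Divisibility using (_∣_; divides; m%n≡0⇒n∣m)
open import Data.Nat.Tactic.RingSolver using (solve-∀)
import Data.Nat.ListAction as List
open import Data.Bool using (Bool; true; false)
open import Data.Fin using (Fin; zero; suc; toℕ; fromℕ<)
open import Data.Fin.Properties using (toℕ-fromℕ<; toℕ-injective; toℕ<n)
import Data.Fin.Properties as Fin
open import Data.Fin.Permutation using (Permutation′; permutation)
open import Data.Fin.Subset using (Subset; _∈_; ∣_∣)
open import Data.Fin.Subset.Properties using (_∈?_)
open import Data.Vec using ([]; _∷_)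
import Data.Vec as Vec
open import Data.Vec.Properties using ([]=⇒lookup; lookup∘tabulate)
open import Data.List using (allFin; tabulate)
open import Data.List.Properties using (map-tabulate)
open import Data.List.Extrema.Nat using (argmax; f[xs]≤f[argmax])
open import Data.List.Membership.Propositional.Properties using (∈-allFin)
import Data.List.Relation.Unary.All as All
open import Data.Product using (_×_; _,_; ∃; proj₁; proj₂)
open import Data.Sum using (_⊎_; inj₁; inj₂)
open import Function using (_∘_; id; case_of_)
open import Relation.Nullary using (¬_; Dec; yes; no; does; contradiction)
open import Relation.Nullary.Decidable using (dec-true; dec-false; _×-dec_; _⊎-dec_)
open import Relation.Binary.PropositionalEquality
open import Algebra.Properties.CommutativeSemigroup +-commutativeSemigroup using (xy∙z≈xz∙y; x∙yz≈y∙xz)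
open import Algebra.Properties.CommutativeMonoid.Sum +-0-commutativeMonoid
  using (sum; sum-cong-≗; sum-replicate-zero; ∑-comm; ∑-permute)
open import Algebra.Properties.Semiring.Sum +-*-semiring using (*-distribˡ-sum)

-- Sums of natural numbers over Fin n

cost≡sum : ∀ {n} (G : Graph n) f → cost G f ≡ sum f
cost≡sum {n} G f = trans (cong List.sum (map-tabulate id f)) (sum-tabulate n f)
  where
  sum-tabulate : ∀ n (f : Fin n → ℕ) → List.sum (tabulate f) ≡ sum f
  sum-tabulate zero    f = refl
  sum-tabulate (suc n) f = cong (f zero +_) (sum-tabulate n (f ∘ suc))

sum-zero : ∀ {n} (h : Fin n → ℕ) → (∀ i → h i ≡ 0) → sum h ≡ 0
sum-zero {n} h h≡0 = trans (sum-cong-≗ h≡0) (sum-replicate-zero n)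

sum≤length : ∀ {n} (h : Fin n → ℕ) → (∀ i → h i ≤ 1) → sum h ≤ n
sum≤length {zero}  h h≤1 = z≤n
sum≤length {suc n} h h≤1 = +-mono-≤ (h≤1 zero) (sum≤length (h ∘ suc) (h≤1 ∘ suc))

sum≡length : ∀ {n} (h : Fin n → ℕ) → (∀ i → h i ≡ 1) → sum h ≡ n
sum≡length {zero}  h h≡1 = refl
sum≡length {suc n} h h≡1 = cong₂ _+_ (h≡1 zero) (sum≡length (h ∘ suc) (h≡1 ∘ suc))

term≤sum : ∀ {n} (h : Fin n → ℕ) i → h i ≤ sum h
term≤sum h zero    = m≤m+n _ _
term≤sum h (suc i) = ≤-trans (term≤sum (h ∘ suc) i) (m≤n+m _ _)

sum<length : ∀ {n} (h : Fin n → ℕ) → (∀ i → h i ≤ 1) → ∀ {i} → h i ≡ 0 → sum h < n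
sum<length {suc n} h h≤1 {zero}  hi≡0 rewrite hi≡0 = s≤s (sum≤length (h ∘ suc) (h≤1 ∘ suc))
sum<length {suc n} h h≤1 {suc i} hi≡0 =
  subst (_≤ suc n) (+-suc (h zero) _) (+-mono-≤ (h≤1 zero) (sum<length (h ∘ suc) (h≤1 ∘ suc) hi≡0))

sum+2≤length : ∀ {n} (h : Fin n → ℕ) → (∀ i → h i ≤ 1) →
               ∀ {i j} → i ≢ j → h i ≡ 0 → h j ≡ 0 → sum h + 2 ≤ n
sum+2≤length h h≤1 {zero} {zero} i≢j _ _ = contradiction refl i≢j
sum+2≤length {suc n} h h≤1 {zero} {suc j} _ hi≡0 hj≡0 rewrite hi≡0 | +-comm (sum (h ∘ suc)) 2 =
  s≤s (sum<length (h ∘ suc) (h≤1 ∘ suc) hj≡0)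
sum+2≤length {suc n} h h≤1 {suc i} {zero} _ hi≡0 hj≡0 rewrite hj≡0 | +-comm (sum (h ∘ suc)) 2 =
  s≤s (sum<length (h ∘ suc) (h≤1 ∘ suc) hi≡0)
sum+2≤length {suc n} h h≤1 {suc i} {suc j} i≢j hi≡0 hj≡0 rewrite +-assoc (h zero) (sum (h ∘ suc)) 2 =
  +-mono-≤ (h≤1 zero) (sum+2≤length (h ∘ suc) (h≤1 ∘ suc) (i≢j ∘ cong suc) hi≡0 hj≡0)

sum≤1 : ∀ {n} (h : Fin n → ℕ) → (∀ i → h i ≤ 1) → (∀ i j → 0 < h i → 0 < h j → i ≡ j) → sum h ≤ 1
sum≤1 {zero}  h h≤1 unique = z≤n
sum≤1 {suc n} h h≤1 unique with h zero in h₀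
... | zero  = sum≤1 (h ∘ suc) (h≤1 ∘ suc) (λ i j p q → Fin.suc-injective (unique (suc i) (suc j) p q))
... | suc k = subst (λ t → suc k + t ≤ 1) (sym (sum-zero (h ∘ suc) tail≡0))
                (subst (_≤ 1) (trans h₀ (sym (+-identityʳ _))) (h≤1 zero))
  where
  tail≡0 : ∀ i → h (suc i) ≡ 0
  tail≡0 i = n≤0⇒n≡0 (≮⇒≥ λ hᵢ>0 → case unique zero (suc i) (subst (0 <_) (sym h₀) z<s) hᵢ>0 of λ ())

𝟙 : Bool → ℕ
𝟙 true  = 1
𝟙 false = 0

module _ {a} {A : Set a} where

  𝟙≤1 : (a? : Dec A) → 𝟙 (does a?) ≤ 1
  𝟙≤1 (yes _) = ≤-refl
  𝟙≤1 (no _)  = z≤n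

  𝟙-yes : (a? : Dec A) → A → 𝟙 (does a?) ≡ 1
  𝟙-yes a? a = cong 𝟙 (dec-true a? a)

  𝟙-no : (a? : Dec A) → ¬ A → 𝟙 (does a?) ≡ 0
  𝟙-no a? ¬a = cong 𝟙 (dec-false a? ¬a)

  𝟙-pos : (a? : Dec A) → 0 < 𝟙 (does a?) → A
  𝟙-pos (yes a) _ = a

count-below : ∀ {n k} → k ≤ n → sum (λ (j : Fin n) → 𝟙 (does (toℕ j <? k))) ≡ k
count-below {n}     {zero}  _         = sum-zero {n} _ (λ _ → refl)
count-below {suc n} {suc k} (s≤s k≤n) = cong suc (count-below k≤n)

-- Walks and distances

least : ∀ {p} {P : ℕ → Set p} → (∀ k → Dec (P k)) →
        ∀ {n} → P n → ∃ λ k → P k × (∀ j → P j → k ≤ j)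
least {P = P} P? {n} pₙ = below n (n , ≤-refl , pₙ)
  where
  below : ∀ n → (∃ λ j → j ≤ n × P j) → ∃ λ k → P k × (∀ j → P j → k ≤ j)
  below zero    (j , j≤0 , pⱼ) rewrite n≤0⇒n≡0 j≤0 = 0 , pⱼ , λ _ _ → z≤n
  below (suc n) (j , j≤1+n , pⱼ) with anyUpTo? P? (suc n)
  ... | yes (i , i<1+n , pᵢ) = below n (i , ≤-pred i<1+n , pᵢ)
  ... | no none = j , pⱼ , λ i pᵢ → ≮⇒≥ λ i<j → none (i , <-≤-trans i<j j≤1+n , pᵢ)

module _ {n} {G : Graph n} where

  _++ʷ_ : ∀ {a b u v w} → Walk G a u v → Walk G b v w → Walk G (a + b) u w
  nil      ++ʷ q = q
  cons e p ++ʷ q = cons e (p ++ʷ q)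

  reverse : (∀ {u v} → G u v → G v u) → ∀ {k u v} → Walk G k u v → Walk G k v u
  reverse sym nil        = nil
  reverse sym {u = u} {v} (cons e p) =
    subst (λ k → Walk G k v u) (+-comm _ 1) (reverse sym p ++ʷ cons (sym e) nil)

  walk? : (∀ u v → Dec (G u v)) → ∀ k u v → Dec (Walk G k u v)
  walk? G? zero u v with u Fin.≟ v
  ... | yes refl = yes nil
  ... | no u≢v   = no λ { nil → u≢v refl }
  walk? G? (suc k) u v with Fin.any? (λ w → G? u w ×-dec walk? G? k w v)
  ... | yes (w , e , p) = yes (cons e p)
  ... | no none         = no λ { (cons e p) → none (_ , e , p) }

  dist-exists : (∀ u v → Dec (G u v)) → ∀ {k u v} → Walk G k u v → ∃ (Dist G u v)
  dist-exists G? {u = u} {v} p = least (λ k → walk? G? k u v) p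

  Dist-unique : ∀ {u v a b} → Dist G u v a → Dist G u v b → a ≡ b
  Dist-unique (pa , mina) (pb , minb) = ≤-antisym (mina _ pb) (minb _ pa)

  ecc-exists : (∀ u v → ∃ (Dist G u v)) → ∀ v → ∃ (IsEcc G v)
  ecc-exists dist v = d far , (far , proj₂ (dist v far)) , d≤d[far]
    where
    d : Fin n → ℕ
    d u = proj₁ (dist v u)
    far : Fin n
    far = argmax d v (allFin n)
    d≤d[far] : ∀ u e → Dist G v u e → e ≤ d far
    d≤d[far] u e D = subst (_≤ d far) (Dist-unique (proj₂ (dist v u)) D)
                           (All.lookup (f[xs]≤f[argmax] {f = d} v (allFin n)) (∈-allFin u))

  distinct-walk : ∀ {k u v} → Walk G k u v → u ≢ v → 1 ≤ k
  distinct-walk nil        u≢v = contradiction refl u≢v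
  distinct-walk (cons _ _) _   = s≤s z≤n

  nonadjacent-walk : ∀ {k u v} → Walk G k u v → u ≢ v → ¬ G u v → 2 ≤ k
  nonadjacent-walk nil                 u≢v _  = contradiction refl u≢v
  nonadjacent-walk (cons e nil)        _   ¬e = contradiction e ¬e
  nonadjacent-walk (cons _ (cons _ _)) _   _  = s≤s (s≤s z≤n)

  ecc-positive : ∀ {v u d e} → v ≢ u → Dist G v u d → IsEcc G v e → 1 ≤ e
  ecc-positive v≢u D (_ , maximal) = ≤-trans (distinct-walk (proj₁ D) v≢u) (maximal _ _ D)

-- Independent sets as broadcasts

indicator : ∀ {n} → Subset n → Fin n → ℕ
indicator S i = 𝟙 (does (i ∈? S))

∣∣≡sum-indicator : ∀ {n} (S : Subset n) → ∣ S ∣ ≡ sum (indicator S)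
∣∣≡sum-indicator []          = refl
∣∣≡sum-indicator (true ∷ S)  = cong suc (∣∣≡sum-indicator S)
∣∣≡sum-indicator (false ∷ S) = ∣∣≡sum-indicator S

module _ {n} {G : Graph n} {S : Subset n} where

  indicator-independent : IsIndependentSet G S → IsIndependent G (indicator S)
  indicator-independent indepS u v u≢v u∈S v∈S d (p , _) =
    ≤-<-trans (𝟙≤1 (u ∈? S)) 1<d , ≤-<-trans (𝟙≤1 (v ∈? S)) 1<d
    where
    1<d : 1 < d
    1<d = nonadjacent-walk p u≢v (indepS u v (𝟙-pos (u ∈? S) u∈S) (𝟙-pos (v ∈? S) v∈S))

  indicator-broadcast : (∀ v → ∃ λ e → IsEcc G v e × 1 ≤ e) → IsBroadcast G (indicator S)
  indicator-broadcast ecc v = let e , isEcc , 1≤e = ecc v in e , isEcc , ≤-trans (𝟙≤1 (v ∈? S)) 1≤e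

evenBelow : ℕ → ℕ → Bool
evenBelow zero    _             = false
evenBelow (suc k) zero          = true
evenBelow (suc k) (suc zero)    = false
evenBelow (suc k) (suc (suc x)) = evenBelow k x

evenBelow-sound : ∀ k x → evenBelow k x ≡ true → x < 2 * k × x % 2 ≡ 0
evenBelow-sound (suc k) zero          _  = subst (0 <_) (sym (*-suc 2 k)) z<s , refl
evenBelow-sound (suc k) (suc (suc x)) eb =
  let x<2k , x%2≡0 = evenBelow-sound k x eb
  in subst (2 + x <_) (sym (*-suc 2 k)) (s≤s (s≤s x<2k)) ,
     trans (cong (_% 2) (+-comm 2 x)) (trans ([m+n]%n≡m%n x 2) x%2≡0)

evens : ∀ {n} → ℕ → Subset n
evens k = Vec.tabulate (λ i → evenBelow k (toℕ i))

∈evens⇒ : ∀ {n k} {i : Fin n} → i ∈ evens k → toℕ i < 2 * k × toℕ i % 2 ≡ 0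
∈evens⇒ {k = k} {i} i∈ = evenBelow-sound k (toℕ i) (trans (sym (lookup∘tabulate _ i)) ([]=⇒lookup i∈))

∣evens∣ : ∀ {n k} → 2 * k ≤ n → ∣ evens {n} k ∣ ≡ k
∣evens∣ {n}             {zero}  _  = ∣evens₀∣ n
  where
  ∣evens₀∣ : ∀ n → ∣ evens {n} 0 ∣ ≡ 0
  ∣evens₀∣ zero    = refl
  ∣evens₀∣ (suc n) = ∣evens₀∣ n
∣evens∣ {zero}          {suc k} le = contradiction le λ ()
∣evens∣ {suc zero}      {suc k} le = contradiction (subst (_≤ 1) (*-suc 2 k) le) λ { (s≤s ()) }
∣evens∣ {suc (suc n)}   {suc k} le = cong suc (∣evens∣ {n} (≤-pred (≤-pred (subst (_≤ 2 + n) (*-suc 2 k) le))))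

-- Arithmetic of walk lengths

steps : ℕ → ℕ
steps (suc (suc (suc g))) = suc (steps g)
steps g                   = g

<steps⇒2*≤ : ∀ {f} g → f < steps g → 2 * f ≤ g
<steps⇒2*≤ {zero}          g                   _   = z≤n
<steps⇒2*≤ {suc _}         zero                ()
<steps⇒2*≤ {suc _}         (suc zero)          (s≤s ())
<steps⇒2*≤ {suc zero}      (suc (suc zero))    _   = ≤-refl
<steps⇒2*≤ {suc (suc _)}   (suc (suc zero))    (s≤s (s≤s ()))
<steps⇒2*≤ {suc f}         (suc (suc (suc g))) (s≤s f<steps) rewrite *-suc 2 f =
  s≤s (s≤s (m≤n⇒m≤1+n (<steps⇒2*≤ g f<steps)))

3*steps≤ : ∀ g → 3 * steps g ≤ g + 4
3*steps≤ zero                = z≤n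
3*steps≤ (suc zero)          = m≤m+n 3 2
3*steps≤ (suc (suc zero))    = ≤-refl
3*steps≤ (suc (suc (suc g))) rewrite *-suc 3 (steps g) = s≤s (s≤s (s≤s (3*steps≤ g)))

<steps⇒3*≤ : ∀ {f} g → f < steps g → 3 * suc f ≤ g + 4
<steps⇒3*≤ g f<steps = ≤-trans (*-monoʳ-≤ 3 f<steps) (3*steps≤ g)

<steps[2*+1]⇒≡2 : ∀ {f} → 0 < f → f < steps (2 * f + 1) → f ≡ 2
<steps[2*+1]⇒≡2 {suc zero}             _ (s≤s ())
<steps[2*+1]⇒≡2 {suc (suc zero)}       _ _ = refl
<steps[2*+1]⇒≡2 {suc (suc (suc k))}    _ f<steps =
  contradiction (subst (_≤ g + 4) (lhs≡ k) (<steps⇒3*≤ g f<steps)) (m+1+n≰m (g + 4))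
  where
  g = 2 * (3 + k) + 1
  lhs≡ : ∀ k → 3 * suc (3 + k) ≡ 2 * (3 + k) + 1 + 4 + suc k
  lhs≡ = solve-∀

<steps[2*]⇒≡1 : ∀ {f} → 0 < f → f < steps (2 * f) → f ≡ 1
<steps[2*]⇒≡1 {suc zero}       _ _ = refl
<steps[2*]⇒≡1 {suc (suc k)}    _ f<steps =
  contradiction (subst (_≤ g + 4) (lhs≡ k) (<steps⇒3*≤ g f<steps)) (m+1+n≰m (g + 4))
  where
  g = 2 * (2 + k)
  lhs≡ : ∀ k → 3 * suc (2 + k) ≡ 2 * (2 + k) + 4 + suc k
  lhs≡ = solve-∀

6*≤+8⇒2*+2≤ : ∀ {e n} → 6 ≤ n → 6 * e ≤ n + 8 → 2 * e + 2 ≤ n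
6*≤+8⇒2*+2≤ {zero}              6≤n _ = ≤-trans (m≤m+n 2 4) 6≤n
6*≤+8⇒2*+2≤ {suc zero}          6≤n _ = ≤-trans (m≤m+n 4 2) 6≤n
6*≤+8⇒2*+2≤ {suc (suc zero)}    6≤n _ = 6≤n
6*≤+8⇒2*+2≤ {suc (suc (suc k))} {n} _ 6e≤n+8 =
  m+n≤o⇒m≤o (2 * e + 2) (+-cancelʳ-≤ 8 _ n (subst (_≤ n + 8) (6e≡ k) 6e≤n+8))
  where
  e = 3 + k
  6e≡ : ∀ k → 6 * (3 + k) ≡ 2 * (3 + k) + 2 + (4 * k + 2) + 8
  6e≡ = solve-∀

2*+2≤3+2*⇒≤ : ∀ {a b} → 2 * a + 2 ≤ 3 + 2 * b → a ≤ b
2*+2≤3+2*⇒≤ {a} {b} le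
  with m≤n⇒m<n∨m≡n (+-cancelʳ-≤ 2 (2 * a) (suc (2 * b)) (subst (2 * a + 2 ≤_) (sym (+-comm (suc (2 * b)) 2)) le))
... | inj₁ 2a<1+2b = *-cancelˡ-≤ 2 (≤-pred 2a<1+2b)
... | inj₂ 2a≡1+2b = contradiction 2a≡1+2b (even≢odd a b)

odd⇒≡3+[∸3]/2*2 : ∀ {n} → 3 ≤ n → ¬ 2 ∣ n → n ≡ 3 + (n ∸ 3) / 2 * 2
odd⇒≡3+[∸3]/2*2 {n} 3≤n n-odd = begin
  n                        ≡⟨ m+[n∸m]≡n 3≤n ⟨
  3 + x                    ≡⟨ cong (3 +_) (m≡m%n+[m/n]*n x 2) ⟩
  3 + (x % 2 + x / 2 * 2)  ≡⟨ cong (λ r → 3 + (r + x / 2 * 2)) x-even ⟩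
  3 + x / 2 * 2            ∎
  where
  open ≡-Reasoning
  x = n ∸ 3
  x-even : x % 2 ≡ 0
  x-even with x % 2 in r≡ | m%n<n x 2
  ... | 0           | _ = refl
  ... | 1           | _ = contradiction (m%n≡0⇒n∣m n 2 (begin
    n % 2                  ≡⟨ cong (_% 2) (m+[n∸m]≡n 3≤n) ⟨
    (3 + x) % 2            ≡⟨ %-distribˡ-+ 3 x 2 ⟩
    (1 + x % 2) % 2        ≡⟨ cong (λ r → (1 + r) % 2) r≡ ⟩
    0                      ∎)) n-odd
  ... | suc (suc _) | s≤s (s≤s ())

-- Clockwise offsets on the n-cycle

module Rotation (m : ℕ) where

  N : ℕ
  N = suc m

  infixl 6 _⊕_

  _⊕_ : Fin N → ℕ → Fin N
  v ⊕ k = fromℕ< (m%n<n (toℕ v + k) N)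

  -- (v - u) mod N; the subtraction N ∸ toℕ u never truncates
  offset : Fin N → Fin N → ℕ
  offset u v = (toℕ v + (N ∸ toℕ u)) % N

  toℕ-⊕ : ∀ v k → toℕ (v ⊕ k) ≡ (toℕ v + k) % N
  toℕ-⊕ v k = toℕ-fromℕ< _

  offset<N : ∀ u v → offset u v < N
  offset<N u v = m%n<n (toℕ v + (N ∸ toℕ u)) N

  %-absorbˡ : ∀ x y → (x % N + y) % N ≡ (x + y) % N
  %-absorbˡ x y = begin
    (x % N + y) % N          ≡⟨ %-distribˡ-+ (x % N) y N ⟩
    (x % N % N + y % N) % N  ≡⟨ cong (λ z → (z + y % N) % N) (m%n%n≡m%n x N) ⟩
    (x % N + y % N) % N      ≡⟨ %-distribˡ-+ x y N ⟨
    (x + y) % N              ∎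
    where open ≡-Reasoning

  %-absorbʳ : ∀ x y → (x + y % N) % N ≡ (x + y) % N
  %-absorbʳ x y = begin
    (x + y % N) % N  ≡⟨ cong (_% N) (+-comm x _) ⟩
    (y % N + x) % N  ≡⟨ %-absorbˡ y x ⟩
    (y + x) % N      ≡⟨ cong (_% N) (+-comm y x) ⟩
    (x + y) % N      ∎
    where open ≡-Reasoning

  ⊕-identityʳ : ∀ v → v ⊕ 0 ≡ v
  ⊕-identityʳ v = toℕ-injective (begin
    toℕ (v ⊕ 0)      ≡⟨ toℕ-⊕ v 0 ⟩
    (toℕ v + 0) % N  ≡⟨ cong (_% N) (+-identityʳ (toℕ v)) ⟩
    toℕ v % N        ≡⟨ m<n⇒m%n≡m (toℕ<n v) ⟩
    toℕ v            ∎)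
    where open ≡-Reasoning

  ⊕-assoc : ∀ v a b → v ⊕ a ⊕ b ≡ v ⊕ (a + b)
  ⊕-assoc v a b = toℕ-injective (begin
    toℕ (v ⊕ a ⊕ b)            ≡⟨ toℕ-⊕ (v ⊕ a) b ⟩
    (toℕ (v ⊕ a) + b) % N      ≡⟨ cong (λ z → (z + b) % N) (toℕ-⊕ v a) ⟩
    ((toℕ v + a) % N + b) % N  ≡⟨ %-absorbˡ (toℕ v + a) b ⟩
    (toℕ v + a + b) % N        ≡⟨ cong (_% N) (+-assoc (toℕ v) a b) ⟩
    (toℕ v + (a + b)) % N      ≡⟨ toℕ-⊕ v (a + b) ⟨
    toℕ (v ⊕ (a + b))          ∎)
    where open ≡-Reasoning

  ⊕-N : ∀ v → v ⊕ N ≡ v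
  ⊕-N v = toℕ-injective (trans (toℕ-⊕ v N) (trans ([m+n]%n≡m%n (toℕ v) N) (m<n⇒m%n≡m (toℕ<n v))))

  offset-self : ∀ v → offset v v ≡ 0
  offset-self v = trans (cong (_% N) (m+[n∸m]≡n (<⇒≤ (toℕ<n v)))) (n%n≡0 N)

  ⊕-offset : ∀ u v → u ⊕ offset u v ≡ v
  ⊕-offset u v = toℕ-injective (begin
    toℕ (u ⊕ offset u v)                  ≡⟨ toℕ-⊕ u _ ⟩
    (toℕ u + offset u v) % N              ≡⟨ %-absorbʳ (toℕ u) _ ⟩
    (toℕ u + (toℕ v + (N ∸ toℕ u))) % N   ≡⟨ cong (_% N) (x+[y+[N∸x]]≡y+N (toℕ v) (<⇒≤ (toℕ<n u))) ⟩
    (toℕ v + N) % N                       ≡⟨ [m+n]%n≡m%n (toℕ v) N ⟩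
    toℕ v % N                             ≡⟨ m<n⇒m%n≡m (toℕ<n v) ⟩
    toℕ v                                 ∎)
    where
    open ≡-Reasoning
    x+[y+[N∸x]]≡y+N : ∀ {x} y → x ≤ N → x + (y + (N ∸ x)) ≡ y + N
    x+[y+[N∸x]]≡y+N {x} y x≤N = trans (x∙yz≈y∙xz x y _) (cong (y +_) (m+[n∸m]≡n x≤N))

  offset-⊕ : ∀ u v k → offset u (v ⊕ k) ≡ (offset u v + k) % N
  offset-⊕ u v k = begin
    (toℕ (v ⊕ k) + (N ∸ toℕ u)) % N         ≡⟨ cong (λ z → (z + (N ∸ toℕ u)) % N) (toℕ-⊕ v k) ⟩
    ((toℕ v + k) % N + (N ∸ toℕ u)) % N     ≡⟨ %-absorbˡ (toℕ v + k) _ ⟩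
    (toℕ v + k + (N ∸ toℕ u)) % N           ≡⟨ cong (_% N) (xy∙z≈xz∙y (toℕ v) k _) ⟩
    (toℕ v + (N ∸ toℕ u) + k) % N           ≡⟨ %-absorbˡ (toℕ v + (N ∸ toℕ u)) k ⟨
    (offset u v + k) % N                    ∎
    where open ≡-Reasoning

  offset-⊕< : ∀ u v k → offset u v + k < N → offset u (v ⊕ k) ≡ offset u v + k
  offset-⊕< u v k <N = trans (offset-⊕ u v k) (m<n⇒m%n≡m <N)

  offset-⊕-self : ∀ v k → k < N → offset v (v ⊕ k) ≡ k
  offset-⊕-self v k k<N = trans (offset-⊕< v v k (subst (λ o → o + k < N) (sym (offset-self v)) k<N))
                                (cong (_+ k) (offset-self v))

  offset≡0⇒≡ : ∀ u v → offset u v ≡ 0 → v ≡ u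
  offset≡0⇒≡ u v o≡0 = trans (sym (⊕-offset u v)) (trans (cong (u ⊕_) o≡0) (⊕-identityʳ u))

  ⊕-≢ : ∀ v k → 0 < k → k < N → v ⊕ k ≢ v
  ⊕-≢ v k 0<k k<N v⊕k≡v =
    <⇒≢ 0<k (trans (sym (offset-self v)) (trans (cong (offset v) (sym v⊕k≡v)) (offset-⊕-self v k k<N)))

  offset+offset≡N : ∀ u v → u ≢ v → offset u v + offset v u ≡ N
  offset+offset≡N u v u≢v = begin
    a + offset v u                  ≡⟨ cong (λ w → a + offset w u) (⊕-offset u v) ⟨
    a + offset (u ⊕ a) u            ≡⟨ cong (λ w → a + offset (u ⊕ a) w) u≡u⊕a⊕[N∸a] ⟩
    a + offset (u ⊕ a) (u ⊕ a ⊕ (N ∸ a)) ≡⟨ cong (a +_) (offset-⊕-self (u ⊕ a) (N ∸ a) N∸a<N) ⟩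
    a + (N ∸ a)                     ≡⟨ m+[n∸m]≡n (<⇒≤ (offset<N u v)) ⟩
    N                               ∎
    where
    open ≡-Reasoning
    a = offset u v
    N∸a<N : N ∸ a < N
    N∸a<N = ∸-monoʳ-< (n≢0⇒n>0 (u≢v ∘ sym ∘ offset≡0⇒≡ u v)) (<⇒≤ (offset<N u v))
    u≡u⊕a⊕[N∸a] : u ≡ u ⊕ a ⊕ (N ∸ a)
    u≡u⊕a⊕[N∸a] =
      sym (trans (⊕-assoc u a _) (trans (cong (u ⊕_) (m+[n∸m]≡n (<⇒≤ (offset<N u v)))) (⊕-N u)))

  offset-⊕-suc< : ∀ u v → suc (offset u v) < N → offset u (v ⊕ 1) ≡ suc (offset u v)
  offset-⊕-suc< u v <N = trans (offset-⊕< u v 1 (subst (_< N) (+-comm 1 _) <N)) (+-comm _ 1)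

  offset-⊕-suc : ∀ u v → offset u (v ⊕ 1) ≡ suc (offset u v) ⊎ v ⊕ 1 ≡ u
  offset-⊕-suc u v with suc (offset u v) <? N
  ... | yes <N = inj₁ (offset-⊕-suc< u v <N)
  ... | no ≮N = inj₂ (offset≡0⇒≡ u (v ⊕ 1) (begin
    offset u (v ⊕ 1)       ≡⟨ offset-⊕ u v 1 ⟩
    (offset u v + 1) % N   ≡⟨ cong (_% N) (trans (+-comm _ 1) 1+o≡N) ⟩
    N % N                  ≡⟨ n%n≡0 N ⟩
    0                      ∎))
    where
    open ≡-Reasoning
    1+o≡N : suc (offset u v) ≡ N
    1+o≡N = ≤-antisym (offset<N u v) (≮⇒≥ ≮N)

  ⊕-cancelˡ : ∀ v {a b} → a < N → b < N → v ⊕ a ≡ v ⊕ b → a ≡ b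
  ⊕-cancelˡ v {a} {b} a<N b<N eq =
    trans (sym (offset-⊕-self v a a<N)) (trans (cong (offset v) eq) (offset-⊕-self v b b<N))

  ⊕-m-1 : ∀ v → v ⊕ m ⊕ 1 ≡ v
  ⊕-m-1 v = trans (⊕-assoc v m 1) (trans (cong (v ⊕_) (+-comm m 1)) (⊕-N v))

  arc-exit : ∀ {u i k} → k < N → offset u i < k → ¬ offset u (i ⊕ 1) < k → offset u (i ⊕ 1) ≡ k
  arc-exit {u} {i} {k} k<N o<k ≮k = ≤-antisym (subst (_≤ k) (sym o⁺≡) o<k) (≮⇒≥ ≮k)
    where
    o⁺≡ : offset u (i ⊕ 1) ≡ suc (offset u i)
    o⁺≡ = offset-⊕-suc< u i (≤-<-trans o<k k<N)

  arc-entry : ∀ {u i k} → offset u (i ⊕ 1) < k → ¬ offset u i < k → i ⊕ 1 ≡ u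
  arc-entry {u} {i} {k} o⁺<k ≮k with offset-⊕-suc u i
  ... | inj₁ o⁺≡ = contradiction (<-trans (n<1+n _) (subst (_< k) o⁺≡ o⁺<k)) ≮k
  ... | inj₂ i⊕1≡u = i⊕1≡u

  offset-permutation : Fin N → Permutation′ N
  offset-permutation v = permutation (λ i → fromℕ< (offset<N v i)) (λ j → v ⊕ toℕ j)
    (λ j → toℕ-injective (trans (toℕ-fromℕ< _) (offset-⊕-self v (toℕ j) (toℕ<n j))))
    (λ i → trans (cong (v ⊕_) (toℕ-fromℕ< _)) (⊕-offset v i))

  sum-offset : ∀ v (h : ℕ → ℕ) → sum (λ i → h (offset v i)) ≡ sum (λ (j : Fin N) → h (toℕ j))
  sum-offset v h = sym (trans (∑-permute {N} {N} (h ∘ toℕ) (offset-permutation v))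
                              (sum-cong-≗ {N} (λ i → cong h (toℕ-fromℕ< (offset<N v i)))))

  arc-size : ∀ v {k} → k ≤ N → sum (λ i → 𝟙 (does (offset v i <? k))) ≡ k
  arc-size v {k} k≤N = trans (sum-offset v (λ o → 𝟙 (does (o <? k)))) (count-below {N} k≤N)

-- The circulant graph C(n;1,3)

module Circulant-1-3 (m : ℕ) (6≤N : 6 ≤ suc m) where

  open Rotation m public

  4<m : 4 < m
  4<m = ≤-pred 6≤N

  1<N : 1 < N
  1<N = <-trans (s≤s z<s) (s≤s 4<m)

  G : Graph N
  G = Circulant N 3

  edge₁ : ∀ v → G v (v ⊕ 1)
  edge₁ v = inj₁ (toℕ-⊕ v 1)

  edge₃ : ∀ v → G v (v ⊕ 3)
  edge₃ v = inj₂ (inj₂ (inj₁ (toℕ-⊕ v 3)))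

  G-sym : ∀ {u v} → G u v → G v u
  G-sym (inj₁ e)               = inj₂ (inj₁ e)
  G-sym (inj₂ (inj₁ e))        = inj₁ e
  G-sym (inj₂ (inj₂ (inj₁ e))) = inj₂ (inj₂ (inj₂ e))
  G-sym (inj₂ (inj₂ (inj₂ e))) = inj₂ (inj₂ (inj₁ e))

  G? : ∀ u v → Dec (G u v)
  G? u v = (toℕ v ≟ _) ⊎-dec (toℕ u ≟ _) ⊎-dec (toℕ v ≟ _) ⊎-dec (toℕ u ≟ _)

  walk-⊕ : ∀ v g → Walk G (steps g) v (v ⊕ g)
  walk-⊕ v zero                = subst (Walk G 0 v) (sym (⊕-identityʳ v)) nil
  walk-⊕ v (suc zero)          = cons (edge₁ v) nil
  walk-⊕ v (suc (suc zero))    = subst (Walk G 2 v) (⊕-assoc v 1 1) (cons (edge₁ v) (cons (edge₁ (v ⊕ 1)) nil))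
  walk-⊕ v (suc (suc (suc g))) = cons (edge₃ v) (subst (Walk G (steps g) (v ⊕ 3)) (⊕-assoc v 3 g) (walk-⊕ (v ⊕ 3) g))

  walk-offset : ∀ u v → Walk G (steps (offset u v)) u v
  walk-offset u v = subst (Walk G _ u) (⊕-offset u v) (walk-⊕ u (offset u v))

  dist : ∀ u v → ∃ (Dist G u v)
  dist u v = dist-exists G? (walk-offset u v)

  Dist≤steps : ∀ {u v d} → Dist G u v d → d ≤ steps (offset u v)
  Dist≤steps {u} {v} (_ , minimal) = minimal _ (walk-offset u v)

  Dist≤steps-back : ∀ {u v d} → Dist G u v d → d ≤ steps (offset v u)
  Dist≤steps-back {u} {v} (_ , minimal) = minimal _ (reverse G-sym (walk-offset v u))

  ecc-bound : ∀ {v e} → IsEcc G v e → 2 * e + 2 ≤ N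
  ecc-bound {v} {e} ((u , D) , _) with v Fin.≟ u
  ... | yes refl rewrite n≤0⇒n≡0 (proj₂ D 0 nil) = ≤-trans (m≤m+n 2 4) 6≤N
  ... | no v≢u = 6*≤+8⇒2*+2≤ {e} 6≤N (begin
    6 * e                                  ≡⟨ *-distribʳ-+ e 3 3 ⟩
    3 * e + 3 * e              ≤⟨ +-mono-≤ (*-monoʳ-≤ 3 (Dist≤steps D)) (*-monoʳ-≤ 3 (Dist≤steps-back D)) ⟩
    3 * steps a + 3 * steps b              ≤⟨ +-mono-≤ (3*steps≤ a) (3*steps≤ b) ⟩
    a + 4 + (b + 4)                        ≡⟨ regroup a b ⟩
    a + b + 8                              ≡⟨ cong (_+ 8) (offset+offset≡N v u v≢u) ⟩
    N + 8                                  ∎)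
    where
    open ≤-Reasoning
    a = offset v u
    b = offset u v
    regroup : ∀ a b → a + 4 + (b + 4) ≡ a + b + 8
    regroup = solve-∀

  ecc : ∀ v → ∃ λ e → IsEcc G v e × 1 ≤ e
  ecc v = let e , isEcc = ecc-exists dist v in
    e , isEcc , ecc-positive (≢-sym (⊕-≢ v 1 z<s 1<N)) (proj₂ (dist v (v ⊕ 1))) isEcc

  independent⇒apart : ∀ {f} → IsIndependent G f → ∀ {u v} → u ≢ v → 0 < f u → 0 < f v →
                      f u < steps (offset u v) × f v < steps (offset u v)
  independent⇒apart indep {u} {v} u≢v fu>0 fv>0 =
    let d , D = dist u v
        fu<d , fv<d = indep u v u≢v fu>0 fv>0 d D
    in <-≤-trans fu<d (Dist≤steps D) , <-≤-trans fv<d (Dist≤steps D)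

  module Packing (f : Fin N → ℕ) (fits : ∀ v → 2 * f v + 2 ≤ N) (indep : IsIndependent G f) where

    Covers : Fin N → Fin N → Set
    Covers v i = offset v i < 2 * f v

    covers? : ∀ v i → Dec (Covers v i)
    covers? v i = offset v i <? 2 * f v

    Covered : Fin N → Set
    Covered i = ∃ λ v → Covers v i

    covered? : ∀ i → Dec (Covered i)
    covered? i = Fin.any? (λ v → covers? v i)

    2*f+1<N : ∀ v → suc (2 * f v) < N
    2*f+1<N v = subst (_≤ N) (+-comm (2 * f v) 2) (fits v)

    2*f<N : ∀ v → 2 * f v < N
    2*f<N v = <-trans (n<1+n _) (2*f+1<N v)

    covers⇒positive : ∀ {v} i → Covers v i → 0 < f v
    covers⇒positive {v} i c with f v
    ... | suc _ = z<s

    covers-self : ∀ {v} → 0 < f v → Covers v v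
    covers-self {v} fv>0 = subst (_< 2 * f v) (sym (offset-self v)) (*-monoʳ-< 2 fv>0)

    covers-unique : ∀ {v t} i → Covers v i → Covers t i → v ≡ t
    covers-unique {v} {t} i cv ct with v Fin.≟ t
    ... | yes v≡t = v≡t
    ... | no v≢t  = contradiction ct (≤⇒≯ (begin
      2 * f t        ≤⟨ <steps⇒2*≤ (offset t v) (proj₁ (independent⇒apart indep (≢-sym v≢t) ft>0 fv>0)) ⟩
      offset t v     ≤⟨ m≤m+n _ a ⟩
      offset t v + a ≡⟨ offset-⊕< t v a offset-tv+a<N ⟨
      offset t (v ⊕ a) ≡⟨ cong (offset t) (⊕-offset v i) ⟩
      offset t i     ∎))
      where
      open ≤-Reasoning
      a = offset v i
      fv>0 = covers⇒positive i cv
      ft>0 = covers⇒positive i ct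
      a<offset : a < offset v t
      a<offset = <-≤-trans cv (<steps⇒2*≤ (offset v t) (proj₁ (independent⇒apart indep v≢t fv>0 ft>0)))
      -- no wrap-around: offset t v + a < offset t v + offset v t = N
      offset-tv+a<N : offset t v + a < N
      offset-tv+a<N = subst (offset t v + a <_) (trans (+-comm (offset t v) (offset v t)) (offset+offset≡N v t v≢t))
                            (+-monoʳ-< (offset t v) a<offset)

    coverage : Fin N → ℕ
    coverage i = sum (λ v → 𝟙 (does (covers? v i)))

    coverage≤1 : ∀ i → coverage i ≤ 1
    coverage≤1 i = sum≤1 _ (λ v → 𝟙≤1 (covers? v i))
      (λ v t cv ct → covers-unique i (𝟙-pos (covers? v i) cv) (𝟙-pos (covers? t i) ct))

    uncovered⇒coverage≡0 : ∀ {i} → ¬ Covered i → coverage i ≡ 0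
    uncovered⇒coverage≡0 {i} ¬c = sum-zero _ (λ v → 𝟙-no (covers? v i) (λ c → ¬c (v , c)))

    coverage≡0⇒uncovered : ∀ {i} → coverage i ≡ 0 → ¬ Covered i
    coverage≡0⇒uncovered {i} c≡0 (v , c) = contradiction
      (subst (_≤ coverage i) (𝟙-yes (covers? v i) c) (term≤sum (λ v → 𝟙 (does (covers? v i))) v))
      (subst (1 ≰_) (sym c≡0) λ ())

    sum-coverage : sum coverage ≡ 2 * sum f
    sum-coverage = begin
      sum coverage                                       ≡⟨ ∑-comm {N} {N} (λ i v → 𝟙 (does (covers? v i))) ⟩
      sum (λ v → sum (λ i → 𝟙 (does (covers? v i))))   ≡⟨ sum-cong-≗ {N} (λ v → arc-size v (<⇒≤ (2*f<N v))) ⟩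
      sum (λ v → 2 * f v)                                ≡⟨ *-distribˡ-sum 2 f ⟨
      2 * sum f                                          ∎
      where open ≡-Reasoning

    packing-bound : 2 * sum f ≤ N
    packing-bound = subst (_≤ N) sum-coverage (sum≤length coverage coverage≤1)

    neighbours-covered⇒radius-2 : ∀ {w v u} → ¬ Covered w → Covers v (w ⊕ m) → Covers u (w ⊕ 1) →
                                  f v ≡ 2 × w ≡ v ⊕ 4
    neighbours-covered⇒radius-2 {w} {v} {u} ¬cw cv cu = fv≡2 , w≡v⊕4
      where
      offset-vw : offset v w ≡ 2 * f v
      offset-vw = subst (λ x → offset v x ≡ 2 * f v) (⊕-m-1 w)
        (arc-exit {v} {w ⊕ m} (2*f<N v) cv λ c → ¬cw (v , subst (Covers v) (⊕-m-1 w) c))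
      offset-vu : offset v u ≡ suc (2 * f v)
      offset-vu = begin
        offset v u              ≡⟨ cong (offset v) (arc-entry {u} {w} cu λ c → ¬cw (u , c)) ⟨
        offset v (w ⊕ 1)        ≡⟨ offset-⊕-suc< v w (subst (λ o → suc o < N) (sym offset-vw) (2*f+1<N v)) ⟩
        suc (offset v w)        ≡⟨ cong suc offset-vw ⟩
        suc (2 * f v)           ∎
        where open ≡-Reasoning
      v≢u : v ≢ u
      v≢u v≡u = 0≢1+n (trans (sym (offset-self v)) (trans (cong (offset v) v≡u) offset-vu))
      fv≡2 : f v ≡ 2
      fv≡2 = <steps[2*+1]⇒≡2 (covers⇒positive (w ⊕ m) cv)
        (subst (λ o → f v < steps o) (trans offset-vu (+-comm 1 _))
          (proj₁ (independent⇒apart indep v≢u (covers⇒positive (w ⊕ m) cv) (covers⇒positive (w ⊕ 1) cu))))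
      w≡v⊕4 : w ≡ v ⊕ 4
      w≡v⊕4 = trans (sym (⊕-offset v w)) (cong (v ⊕_) (trans offset-vw (cong (2 *_) fv≡2)))

    radius-2⇒predecessor-uncovered : ∀ {v} → f v ≡ 2 → ¬ Covered (v ⊕ m)
    radius-2⇒predecessor-uncovered {v} fv≡2 (t , ct) =
      contradiction (proj₂ apart) (subst (_≮ steps (offset t v)) (sym fv≡2) 2≮steps)
      where
      fv>0 : 0 < f v
      fv>0 = subst (0 <_) (sym fv≡2) z<s
      ft>0 = covers⇒positive (v ⊕ m) ct
      t≢v : t ≢ v
      t≢v refl = <⇒≯ 4<m (subst₂ _<_ (offset-⊕-self t m ≤-refl) (cong (2 *_) fv≡2) ct)
      apart = independent⇒apart indep t≢v ft>0 fv>0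
      offset-tv : offset t v ≡ 2 * f t
      offset-tv = subst (λ x → offset t x ≡ 2 * f t) (⊕-m-1 v)
        (arc-exit {t} {v ⊕ m} (2*f<N t) ct λ c →
          t≢v (covers-unique v (subst (Covers t) (⊕-m-1 v) c) (covers-self fv>0)))
      ft≡1 : f t ≡ 1
      ft≡1 = <steps[2*]⇒≡1 ft>0 (subst (λ o → f t < steps o) offset-tv (proj₁ apart))
      2≮steps : 2 ≮ steps (offset t v)
      2≮steps = subst (λ o → 2 ≮ steps o) (sym (trans offset-tv (cong (2 *_) ft≡1))) (<-irrefl refl)

    two-uncovered : ∀ {w} → ¬ Covered w → ∃ λ w' → w' ≢ w × ¬ Covered w'
    two-uncovered {w} ¬cw with covered? (w ⊕ m) | covered? (w ⊕ 1)
    ... | no ¬c | _     = w ⊕ m , ⊕-≢ w m (<-trans z<s 4<m) ≤-refl , ¬c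
    ... | yes _ | no ¬c = w ⊕ 1 , ⊕-≢ w 1 z<s 1<N , ¬c
    ... | yes (v , cv) | yes (u , cu) =
      let fv≡2 , w≡v⊕4 = neighbours-covered⇒radius-2 ¬cw cv cu in
      v ⊕ m , (λ eq → >⇒≢ 4<m (⊕-cancelˡ v ≤-refl (<-trans 4<m ≤-refl) (trans eq w≡v⊕4))) ,
      radius-2⇒predecessor-uncovered fv≡2

    odd-packing-bound : ¬ 2 ∣ N → 2 * sum f + 2 ≤ N
    odd-packing-bound N-odd with Fin.any? (λ i → coverage i ≟ 0)
    ... | yes (w , cw≡0) =
      let w' , w'≢w , ¬cw' = two-uncovered {w} (coverage≡0⇒uncovered {w} cw≡0) in
      subst (λ s → s + 2 ≤ N) sum-coverage
        (sum+2≤length coverage coverage≤1 w'≢w (uncovered⇒coverage≡0 {w'} ¬cw') cw≡0)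
    ... | no none = contradiction (divides (sum f) (trans (sym sum-coverage≡N) (*-comm 2 (sum f)))) N-odd
      where
      sum-coverage≡N : 2 * sum f ≡ N
      sum-coverage≡N = trans (sym sum-coverage) (sum≡length coverage λ i →
        ≤-antisym (coverage≤1 i) (n≢0⇒n>0 λ c≡0 → none (i , c≡0)))

  evens-independent : ∀ {k} → 2 ∣ N ⊎ 2 * k + 3 ≤ N → IsIndependentSet G (evens k)
  evens-independent {k} no-wrap u v u∈ v∈ = no-edge
    where
    no-step : ∀ {x y s} → x < 2 * k → x % 2 ≡ 0 → y % 2 ≡ 0 → s ≤ 3 → s % 2 ≡ 1 → y ≢ (x + s) % N
    no-step {x} {y} {s} x<2k x-even y-even s≤3 s-odd y≡ = 0≢1+n (begin
      0                        ≡⟨ y-even ⟨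
      y % 2                    ≡⟨ cong (_% 2) y≡ ⟩
      (x + s) % N % 2          ≡⟨ reduce no-wrap ⟩
      (x + s) % 2              ≡⟨ %-distribˡ-+ x s 2 ⟩
      (x % 2 + s % 2) % 2      ≡⟨ cong₂ (λ a b → (a + b) % 2) x-even s-odd ⟩
      1                        ∎)
      where
      open ≡-Reasoning
      reduce : 2 ∣ N ⊎ 2 * k + 3 ≤ N → (x + s) % N % 2 ≡ (x + s) % 2
      reduce (inj₁ 2∣N)   = m∣n⇒o%n%m≡o%m 2 N (x + s) 2∣N
      reduce (inj₂ 2k+3≤N) = cong (_% 2) (m<n⇒m%n≡m (<-≤-trans (+-mono-<-≤ x<2k s≤3) 2k+3≤N))
    x<2k = proj₁ (∈evens⇒ {k = k} u∈)
    x-even = proj₂ (∈evens⇒ {k = k} u∈)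
    y<2k = proj₁ (∈evens⇒ {k = k} v∈)
    y-even = proj₂ (∈evens⇒ {k = k} v∈)
    no-edge : ¬ G u v
    no-edge (inj₁ e)               = no-step x<2k x-even y-even (m≤m+n 1 2) refl e
    no-edge (inj₂ (inj₁ e))        = no-step y<2k y-even x-even (m≤m+n 1 2) refl e
    no-edge (inj₂ (inj₂ (inj₁ e))) = no-step x<2k x-even y-even ≤-refl refl e
    no-edge (inj₂ (inj₂ (inj₂ e))) = no-step y<2k y-even x-even ≤-refl refl e

  broadcast⇒fits : ∀ {f} → IsBroadcast G f → ∀ v → 2 * f v + 2 ≤ N
  broadcast⇒fits bf v = let e , isEcc , fv≤e = bf v in
    ≤-trans (+-monoˡ-≤ 2 (*-monoʳ-≤ 2 fv≤e)) (ecc-bound isEcc)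

  indicator-fits : ∀ (S : Subset N) v → 2 * indicator S v + 2 ≤ N
  indicator-fits S v = ≤-trans (+-monoˡ-≤ 2 (*-monoʳ-≤ 2 (𝟙≤1 (v ∈? S)))) (≤-trans (m≤m+n 4 2) 6≤N)

  β≡α≡_ : ℕ → Set
  β≡α≡ k = IsBroadcastIndependenceNumber G k × IsIndependenceNumber G k

  packing⇒β≡α≡ : ∀ k → (∀ f → (∀ v → 2 * f v + 2 ≤ N) → IsIndependent G f → sum f ≤ k) →
                 (S : Subset N) → IsIndependentSet G S → ∣ S ∣ ≡ k → β≡α≡ k
  packing⇒β≡α≡ k bound S indepS ∣S∣≡k =
    ( (indicator S , indicator-broadcast ecc , indicator-independent indepS ,
       trans (cost≡sum G (indicator S)) (trans (sym (∣∣≡sum-indicator S)) ∣S∣≡k))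
    , λ f bf indep → subst (_≤ k) (sym (cost≡sum G f)) (bound f (broadcast⇒fits bf) indep))
    , ( (S , indepS , ∣S∣≡k)
      , λ T indepT → subst (_≤ k) (sym (∣∣≡sum-indicator T))
                       (bound (indicator T) (indicator-fits T) (indicator-independent indepT)))

  even-case : ∀ q → N ≡ q * 2 → β≡α≡ q
  even-case q N≡q*2 =
    packing⇒β≡α≡ q bound (evens q) (evens-independent {q} (inj₁ (divides q N≡q*2))) (∣evens∣ (≤-reflexive 2q≡N))
    where
    2q≡N : 2 * q ≡ N
    2q≡N = trans (*-comm 2 q) (sym N≡q*2)
    bound : ∀ f → (∀ v → 2 * f v + 2 ≤ N) → IsIndependent G f → sum f ≤ q
    bound f fits indep = *-cancelˡ-≤ 2 (≤-trans (Packing.packing-bound f fits indep) (≤-reflexive (sym 2q≡N)))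

  odd-case : ∀ p → N ≡ 3 + p * 2 → β≡α≡ p
  odd-case p N≡3+p*2 =
    packing⇒β≡α≡ p bound (evens p) (evens-independent {p} (inj₂ 2p+3≤N)) (∣evens∣ (m+n≤o⇒m≤o (2 * p) 2p+3≤N))
    where
    N≡3+2p : N ≡ 3 + 2 * p
    N≡3+2p = trans N≡3+p*2 (cong (3 +_) (*-comm p 2))
    2p+3≤N : 2 * p + 3 ≤ N
    2p+3≤N = ≤-reflexive (trans (+-comm (2 * p) 3) (sym N≡3+2p))
    N-odd : ¬ 2 ∣ N
    N-odd (divides q N≡q*2) =
      even≢odd q (suc p) (trans (trans (*-comm 2 q) (sym N≡q*2)) (trans N≡3+2p (cong suc (sym (*-suc 2 p)))))
    bound : ∀ f → (∀ v → 2 * f v + 2 ≤ N) → IsIndependent G f → sum f ≤ p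
    bound f fits indep =
      2*+2≤3+2*⇒≤ (≤-trans (Packing.odd-packing-bound f fits indep N-odd) (≤-reflexive N≡3+2p))

theorem19 : (n : ℕ) → 6 ≤ n →
    (2 ∣ n → IsBroadcastIndependenceNumber (Circulant n 3) (n / 2)
               × IsIndependenceNumber (Circulant n 3) (n / 2))
    × (¬ (2 ∣ n) → IsBroadcastIndependenceNumber (Circulant n 3) ((n ∸ 3) / 2)
                     × IsIndependenceNumber (Circulant n 3) ((n ∸ 3) / 2))
theorem19 (suc m) 6≤n = even , odd
  where
  open Circulant-1-3 m 6≤n
  even : 2 ∣ suc m → β≡α≡ (suc m / 2)
  even (divides q n≡q*2) = subst β≡α≡_ (sym (trans (cong (_/ 2) n≡q*2) (m*n/n≡m q 2))) (even-case q n≡q*2)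
  odd : ¬ 2 ∣ suc m → β≡α≡ ((suc m ∸ 3) / 2)
  odd n-odd = odd-case _ (odd⇒≡3+[∸3]/2*2 (≤-trans (m≤m+n 3 3) 6≤n) n-odd)
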